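{- Every strongly consistent canonical system is coherent.
   Context: $\mathcal{L}$ is a propositional language with atoms $p_1,p_2,\ldots$ and set of formulas $\mathcal{F}$. A sequent is $\Gamma\Rightarrow E$ with $\Gamma$ a finite set of formulas and $E$ a set of formulas with at most one element ($\Rightarrow$ alone denotes the empty sequent). A clause is a sequent of atoms. An $\mathcal{L}$-substitution is a map $\sigma:\mathcal{F}\to\mathcal{F}$ commuting with all connectives, extended pointwise to sets. A canonical right-introduction rule for an $n$-ary connective $\diamond$ is $\{\Pi_i\Rightarrow E_i\}_{1\le i\le m}/\ \Rightarrow\diamond(p_1,\dots,p_n)$ with $m\ge0$ and $\Pi_i\cup E_i\subseteq\{p_1,\dots,p_n\}$; an application infers $\Gamma\Rightarrow\sigma(\diamond(p_1,\dots,p_n))$ from $\Gamma,\sigma(\Pi_i)\Rightarrow\sigma(E_i)$ ($1\le i\le m$), for any finite $\Gamma$ and substitution $\sigma$. A canonical left-introduction rule is $\langle\{\Pi_i\Rightarrow E_i\}_{1\le i\le m},\{\Sigma_j\Rightarrow\}_{1\le j\le k}\rangle/\ \diamond(p_1,\dots,p_n)\Rightarrow$ with all atoms among $p_1,\dots,p_n$; an application infers $\Gamma,\sigma(\diamond(p_1,\dots,p_n))\Rightarrow E$ from $\Gamma,\sigma(\Pi_i)\Rightarrow\sigma(E_i)$ and $\Gamma,\sigma(\Sigma_j)\Rightarrow E$, for any sequent $\Gamma\Rightarrow E$ and substitution $\sigma$. A canonical system has axioms $\varphi\Rightarrow\varphi$, weakening (from $\Gamma\Rightarrow E$ infer $\Gamma,\Delta\Rightarrow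 E$; from $\Gamma\Rightarrow$ infer $\Gamma\Rightarrow\psi$), cut (from $\Gamma\Rightarrow\varphi$ and $\Delta,\varphi\Rightarrow E$ infer $\Gamma,\Delta\Rightarrow E$), and a set of canonical right- and left-introduction rules. $\mathcal{S}\vdash^{seq}_{\mathbf G}s$ means $s$ is derivable in $\mathbf G$ from the sequents of $\mathcal S$ as extra axioms. $\mathbf G$ is strongly consistent iff $(\Rightarrow p_1),(p_2\Rightarrow)\not\vdash^{seq}_{\mathbf G}\ \Rightarrow$. A classical assignment $u$ satisfies a clause $\Pi\Rightarrow E$ iff $u(p)=f$ for some $p\in\Pi$ or $E=\{q\}$ with $u(q)=t$; a set of clauses is classically inconsistent iff no assignment satisfies all of them. $\mathbf G$ is coherent iff for every connective $\diamond$, whenever $\mathbf G$ contains a left rule $\langle S_1,S_2\rangle/\diamond(p_1,\dots,p_n)\Rightarrow$ and a right rule $S_3/\Rightarrow\diamond(p_1,\dots,p_n)$, the set $S_1\cup S_2\cup S_3$ is classically inconsistent. -}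

module Defs where

open import Data.Nat using (ℕ)
open import Data.Fin using (Fin; toℕ)
open import Data.Bool using (Bool; true; false)
open import Data.List using (List; []; _∷_; _++_; map)
open import Data.Maybe using (Maybe; just; nothing)
import Data.Maybe as Maybe
open import Data.Product using (_×_; _,_; proj₁; proj₂; Σ)
open import Data.Sum using (_⊎_)
open import Data.List.Membership.Propositional using (_∈_)
open import Data.List.Relation.Binary.Subset.Propositional using (_⊆_)
open import Data.List.Relation.Unary.Any using (Any)
open import Data.List.Relation.Unary.All using (All)
open import Relation.Binary.PropositionalEquality using (_≡_)
open import Relation.Nullary using (¬_)

-- A propositional language: a set of connectives, each with an arity.
-- Atoms p₁, p₂, … are represented by  atom 0, atom 1, …  (p_{i+1} = atom i).
record Language : Set₁ where
  field
    Con   : Set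
    arity : Con → ℕ

module _ (L : Language) where
  open Language L

  data Formula : Set where
    atom : ℕ → Formula
    app  : (c : Con) → (Fin (arity c) → Formula) → Formula

  -- Γ ⇒ E : Γ a finite set (list up to set-equality, handled by weakening
  -- along ⊆), E a set with at most one element.
  Sequent : Set
  Sequent = List Formula × Maybe Formula

  -- A clause over the atoms p₁,…,pₙ (atoms of a rule schema for an n-ary ◇).
  Clause : ℕ → Set
  Clause n = List (Fin n) × Maybe (Fin n)

  -- Canonical right rule  {Πᵢ ⇒ Eᵢ} / ⇒ ◇(p₁,…,pₙ)
  RightRule : Con → Set
  RightRule c = List (Clause (arity c))

  -- Canonical left rule  ⟨{Πᵢ ⇒ Eᵢ}, {Σⱼ ⇒}⟩ / ◇(p₁,…,pₙ) ⇒
  LeftRule : Con → Set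
  LeftRule c = List (Clause (arity c)) × List (List (Fin (arity c)))

  record System : Set₁ where
    field
      Right : (c : Con) → RightRule c → Set
      Left  : (c : Con) → LeftRule c → Set

  instΠ : {n : ℕ} → (Fin n → Formula) → List (Fin n) → List Formula
  instΠ σ Π = map (λ i → σ i) Π

  instE : {n : ℕ} → (Fin n → Formula) → Maybe (Fin n) → Maybe Formula
  instE σ E = Maybe.map (λ i → σ i) E

  data Derivable (G : System) (𝒮 : Sequent → Set) : Sequent → Set where
    hyp   : ∀ {s} → 𝒮 s → Derivable G 𝒮 s
    ax    : ∀ φ → Derivable G 𝒮 (φ ∷ [] , just φ)
    weakL : ∀ {Γ Δ E} → Γ ⊆ Δ → Derivable G 𝒮 (Γ , E) → Derivable G 𝒮 (Δ , E)
    weakR : ∀ {Γ} ψ → Derivable G 𝒮 (Γ , nothing) → Derivable G 𝒮 (Γ , just ψ)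
    cut   : ∀ {Γ Δ E} φ → Derivable G 𝒮 (Γ , just φ) → Derivable G 𝒮 (φ ∷ Δ , E)
          → Derivable G 𝒮 (Γ ++ Δ , E)
    right : ∀ (c : Con) (R : RightRule c) → System.Right G c R
          → (σ : Fin (arity c) → Formula) (Γ : List Formula)
          → (∀ {cl} → cl ∈ R → Derivable G 𝒮 (Γ ++ instΠ σ (proj₁ cl) , instE σ (proj₂ cl)))
          → Derivable G 𝒮 (Γ , just (app c σ))
    left  : ∀ (c : Con) (R : LeftRule c) → System.Left G c R
          → (σ : Fin (arity c) → Formula) (Γ : List Formula) (E : Maybe Formula)
          → (∀ {cl} → cl ∈ proj₁ R → Derivable G 𝒮 (Γ ++ instΠ σ (proj₁ cl) , instE σ (proj₂ cl)))
          → (∀ {Σ′} → Σ′ ∈ proj₂ R → Derivable G 𝒮 (Γ ++ instΠ σ Σ′ , E))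
          → Derivable G 𝒮 (app c σ ∷ Γ , E)

  StrongAxioms : Sequent → Set
  StrongAxioms s = (s ≡ ([] , just (atom 0))) ⊎ (s ≡ (atom 1 ∷ [] , nothing))

  StronglyConsistent : System → Set
  StronglyConsistent G = ¬ Derivable G StrongAxioms ([] , nothing)

  -- Classical assignments on atoms; atom pᵢ of a rule schema is i : Fin n.
  Satisfies : {n : ℕ} → (ℕ → Bool) → Clause n → Set
  Satisfies u (Π , E) =
    Any (λ p → u (toℕ p) ≡ false) Π ⊎ Σ _ (λ q → E ≡ just q × u (toℕ q) ≡ true)

  ClassicallyInconsistent : {n : ℕ} → List (Clause n) → Set
  ClassicallyInconsistent S = ∀ (u : ℕ → Bool) → ¬ All (Satisfies u) S

  negClauses : {n : ℕ} → List (List (Fin n)) → List (Clause n)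
  negClauses Ss = map (λ Σ′ → Σ′ , nothing) Ss

  Coherent : System → Set
  Coherent G = ∀ (c : Con) (Lr : LeftRule c) (Rr : RightRule c)
    → System.Left G c Lr → System.Right G c Rr
    → ClassicallyInconsistent (proj₁ Lr ++ negClauses (proj₂ Lr) ++ Rr)

-- A satisfying assignment u of the clauses of a left rule and a right rule for ◇
-- yields a refutation of (⇒ p₁), (p₂ ⇒): substitute p₁ for every atom that u makes
-- true and p₂ for every atom it makes false.  Each satisfied premise then becomes an
-- instance of an axiom, up to weakening, so both rules apply with Γ empty, and a cut
-- on the resulting ◇-formula derives the empty sequent.
module Submission where

open import Defs
open import Data.Nat using (ℕ)
open import Data.Fin using (Fin; toℕ)
open import Data.Bool using (Bool; true; false; if_then_else_)
open import Data.List using (List; []; _∷_; _++_)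
open import Data.Maybe using (Maybe; just; nothing)
open import Data.Product using (_,_)
open import Data.Sum using (inj₁; inj₂)
open import Data.List.Membership.Propositional using (_∈_)
open import Data.List.Relation.Unary.Any using (Any; here; there)
open import Data.List.Relation.Unary.All using (All; lookup)
open import Data.List.Relation.Unary.All.Properties using (++⁻ˡ; ++⁻ʳ; map⁻)
open import Relation.Binary.PropositionalEquality using (_≡_; refl; sym)

module _ {L : Language} {G : System L} {𝒮 : Sequent L → Set} where

  weakenRight : ∀ {Γ} (E : Maybe (Formula L))
    → Derivable L G 𝒮 (Γ , nothing) → Derivable L G 𝒮 (Γ , E)
  weakenRight nothing  d = d
  weakenRight (just ψ) d = weakR ψ d

module Refutation {L : Language} (G : System L) (u : ℕ → Bool) where

  StrongDerivable : Sequent L → Set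
  StrongDerivable = Derivable L G (StrongAxioms L)

  substOf : ∀ {n} → Fin n → Formula L
  substOf i = if u (toℕ i) then atom 0 else atom 1

  substOf-false : ∀ {n} (p : Fin n) → u (toℕ p) ≡ false → substOf p ≡ atom 1
  substOf-false p up rewrite up = refl

  substOf-true : ∀ {n} (p : Fin n) → u (toℕ p) ≡ true → substOf p ≡ atom 0
  substOf-true p up rewrite up = refl

  atom1∈instΠ : ∀ {n} (Π : List (Fin n))
    → Any (λ p → u (toℕ p) ≡ false) Π → atom 1 ∈ instΠ L substOf Π
  atom1∈instΠ (p ∷ _) (here up)  = here (sym (substOf-false p up))
  atom1∈instΠ (_ ∷ Π) (there fs) = there (atom1∈instΠ Π fs)

  refuteFalsified : ∀ {n} (Π : List (Fin n))
    → Any (λ p → u (toℕ p) ≡ false) Π → StrongDerivable (instΠ L substOf Π , nothing)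
  refuteFalsified Π fs = weakL (λ { (here refl) → atom1∈instΠ Π fs }) (hyp (inj₂ refl))

  satisfied⇒derivable : ∀ {n} (Π : List (Fin n)) (E : Maybe (Fin n))
    → Satisfies L u (Π , E) → StrongDerivable (instΠ L substOf Π , instE L substOf E)
  satisfied⇒derivable Π E (inj₁ fs) = weakenRight _ (refuteFalsified Π fs)
  satisfied⇒derivable Π (just q) (inj₂ (.q , refl , uq)) rewrite substOf-true q uq =
    weakL (λ ()) (hyp (inj₁ refl))

  satisfiedNeg⇒derivable : ∀ {n} (Σ′ : List (Fin n))
    → Satisfies L u (Σ′ , nothing) → StrongDerivable (instΠ L substOf Σ′ , nothing)
  satisfiedNeg⇒derivable Σ′ (inj₁ fs)       = refuteFalsified Σ′ fs
  satisfiedNeg⇒derivable Σ′ (inj₂ (_ , () , _))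

  refute : ∀ c (Ls : List (Clause L (Language.arity L c))) (Ss : List (List (Fin (Language.arity L c))))
    (Rr : RightRule L c) → System.Left G c (Ls , Ss) → System.Right G c Rr
    → All (Satisfies L u) (Ls ++ negClauses L Ss ++ Rr)
    → StrongDerivable ([] , nothing)
  refute c Ls Ss Rr l r sat =
    cut (app c substOf)
      (right c Rr r substOf [] (λ m → satisfied⇒derivable _ _ (lookup satR m)))
      (left c (Ls , Ss) l substOf [] nothing
        (λ m → satisfied⇒derivable _ _ (lookup satL m))
        (λ {Σ′} m → satisfiedNeg⇒derivable Σ′ (lookup satS m)))
    where
      satL : All (Satisfies L u) Ls
      satL = ++⁻ˡ Ls sat
      satS : All (λ Σ′ → Satisfies L u (Σ′ , nothing)) Ss
      satS = map⁻ (++⁻ˡ (negClauses L Ss) (++⁻ʳ Ls sat))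
      satR : All (Satisfies L u) Rr
      satR = ++⁻ʳ (negClauses L Ss) (++⁻ʳ Ls sat)

theorem4p10 : (L : Language) (G : System L)
    → StronglyConsistent L G → Coherent L G
theorem4p10 L G consistent c (Ls , Ss) Rr l r u sat =
  consistent (Refutation.refute G u c Ls Ss Rr l r sat)
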